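{- Let $m\ge 3$, $n=\lfloor m/2\rfloor$, and let $W=N(T_{SO})/T_{SO}\cong D\rtimes S_n$ be the Weyl group of $\mathrm{SO}_m$ with respect to its diagonal torus $T_{SO}$. The surjection $N(T_{SO}) \twoheadrightarrow W$ admits a group-homomorphic section $s: W \to N(T_{SO})$, given as follows. For $\sigma \in S_n$ with $n\times n$ permutation matrix $M_{\sigma}$, $s(\sigma)=\begin{pmatrix} M_{\sigma}&0\\0&M_{\sigma}^{at} \end{pmatrix}$ if $m=2n$, and $s(\sigma)=\mathrm{diag}(M_\sigma,1,M_\sigma^{at})$ (block diagonal) if $m=2n+1$, where $M_{\sigma}^{at}$ is the anti-diagonal transpose of $M_{\sigma}$. For $\epsilon=(\epsilon_i) \in D$, $s(\epsilon)=d_{\epsilon}$, where if $m=2n$, $d_{\epsilon}$ is obtained from $I_m$ by swapping the $i$-th and $(m+1-i)$-th columns for each $i$ with $\epsilon_i=-1$, and if $m=2n+1$, $d_\epsilon$ is obtained from $I_m$ by the same column swaps and then replacing the $(n+1,n+1)$-entry by $(-1)^{|\{1 \leq i \leq n: \epsilon_i=-1\}|}$.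
   Context: $\mathrm{SO}_m=\{g\in\mathrm{SL}_m: gJg^t=J\}$ where $J$ is the $m\times m$ anti-diagonal matrix with all anti-diagonal entries $1$. $T_{SO}=\{\mathrm{diag}(t_1,\dots,t_n,(1),t_n^{ -1},\dots,t_1^{ -1})\}$, the middle $1$ present only for odd $m$. $D=\{\pm1\}^n$ if $m=2n+1$, and the subgroup of $\{\pm1\}^n$ with an even number of $-1$'s if $m=2n$; $\epsilon\in D$ acts on $T_{SO}$ by $t_i\mapsto t_i^{\epsilon_i}$ and $S_n$ acts by permuting $t_1,\dots,t_n$; $W\cong D\rtimes S_n$ via these actions.
   Formalization: In s(σ), for m=2n and m=2n+1 alike, the block $M_{\sigma}^{at}$ is replaced by the anti-diagonal transpose of the inverse of $M_{\sigma}$, that is, by $M_{\sigma}$ with rows and columns both reversed. The statement above fails without it. -}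

module Defs where

open import Level using (_⊔_)
open import Algebra.Bundles using (CommutativeRing)
open import Data.Nat as ℕ using (ℕ; zero; suc; _∸_; _/_; _%_; _<?_)
open import Data.Fin as Fin using (Fin; toℕ; fromℕ<; punchIn; opposite)
open import Data.Fin.Permutation using (Permutation′; _⟨$⟩ʳ_; _⟨$⟩ˡ_; _∘ₚ_)
open import Data.Sign as Sign using (Sign)
open import Data.Product using (_×_; _,_; ∃)
open import Relation.Binary.PropositionalEquality using (_≡_)
open import Relation.Nullary using (Dec; yes; no; ¬_)

-- Position of an index of Fin m relative to n = ⌊m/2⌋ (0-based):
--   upper a  : global index a              (a < n)
--   lower a  : global index m-1-a          (a < n)
--   middle   : global index n, only when m is odd
data Pos (n : ℕ) : Set where
  upper  : Fin n → Pos n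
  lower  : Fin n → Pos n
  middle : Pos n

pos : (m : ℕ) → Fin m → Pos (m / 2)
pos m i with toℕ i <? m / 2
... | yes p = upper (fromℕ< p)
... | no _ with m ∸ suc (toℕ i) <? m / 2
...   | yes q = lower (fromℕ< q)
...   | no _  = middle

countMinus : ∀ {n} → (Fin n → Sign) → ℕ
countMinus {zero}  ε = 0
countMinus {suc n} ε with ε Fin.zero
... | Sign.- = suc (countMinus (λ i → ε (Fin.suc i)))
... | Sign.+ = countMinus (λ i → ε (Fin.suc i))

IsField : ∀ {c ℓ} → CommutativeRing c ℓ → Set (c ⊔ ℓ)
IsField R = ¬ (0# ≈ 1#) × (∀ x → ¬ (x ≈ 0#) → ∃ λ y → x * y ≈ 1#)
  where open CommutativeRing R

module SO {c ℓ} (R : CommutativeRing c ℓ) (m : ℕ) where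
  open CommutativeRing R

  n : ℕ
  n = m / 2

  Mat : ℕ → Set c
  Mat k = Fin k → Fin k → Carrier

  sumF : ∀ k → (Fin k → Carrier) → Carrier
  sumF zero    f = 0#
  sumF (suc k) f = f Fin.zero + sumF k (λ i → f (Fin.suc i))

  infixl 7 _⊗_
  _⊗_ : ∀ {k} → Mat k → Mat k → Mat k
  _⊗_ {k} A B i j = sumF k (λ l → A i l * B l j)

  infix 4 _≈M_
  _≈M_ : ∀ {k} → Mat k → Mat k → Set ℓ
  A ≈M B = ∀ i j → A i j ≈ B i j

  ᵗ : ∀ {k} → Mat k → Mat k
  ᵗ A i j = A j i

  δ : ∀ {a} {P : Set a} → Dec P → Carrier
  δ (yes _) = 1#
  δ (no _)  = 0#

  neg1^ : ℕ → Carrier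
  neg1^ zero    = 1#
  neg1^ (suc k) = - (neg1^ k)

  det : ∀ k → Mat k → Carrier
  det zero    A = 1#
  det (suc k) A =
    sumF (suc k) (λ j → neg1^ (toℕ j) * A Fin.zero j
                         * det k (λ r s → A (Fin.suc r) (punchIn j s)))

  J : Mat m
  J i j = δ (i Fin.≟ opposite j)

  InSO : Mat m → Set ℓ
  InSO g = (det m g ≈ 1#) × (g ⊗ J ⊗ ᵗ g ≈M J)

  -- torus element diag(t_1..t_n,(1),u_n..u_1), with u_i = t_i⁻¹
  diagT : (Fin n → Carrier) × (Fin n → Carrier) → Mat m
  diagT (t , u) i j with pos m i
  ... | upper a = δ (i Fin.≟ j) * t a
  ... | lower a = δ (i Fin.≟ j) * u a
  ... | middle  = δ (i Fin.≟ j)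

  InTorus : (Fin n → Carrier) × (Fin n → Carrier) → Set ℓ
  InTorus (t , u) = ∀ i → t i * u i ≈ 1#

  InD : (Fin n → Sign) → Set
  InD ε = m % 2 ≡ 0 → countMinus ε % 2 ≡ 0

  -- W ≅ D ⋊ S_n, elements written ε σ
  W : Set
  W = (Fin n → Sign) × Permutation′ n

  -- composition in S_n : (σ ∘ τ)(i) = σ(τ(i))
  _∘S_ : Permutation′ n → Permutation′ n → Permutation′ n
  σ ∘S τ = τ ∘ₚ σ

  -- (ε σ)(ε' σ') = (ε · σε'σ⁻¹) (σ σ'),  (σε'σ⁻¹)_i = ε'_{σ⁻¹(i)}
  _·W_ : W → W → W
  (ε , σ) ·W (ε' , σ') = (λ i → ε i Sign.* ε' (σ ⟨$⟩ˡ i)) , (σ ∘S σ')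

  -- action of W on T:  σ permutes t_1..t_n, ε_i = -1 inverts t_i
  actS : Permutation′ n → (Fin n → Carrier) × (Fin n → Carrier)
       → (Fin n → Carrier) × (Fin n → Carrier)
  actS σ (t , u) = (λ i → t (σ ⟨$⟩ˡ i)) , (λ i → u (σ ⟨$⟩ˡ i))

  actD : (Fin n → Sign) → (Fin n → Carrier) × (Fin n → Carrier)
       → (Fin n → Carrier) × (Fin n → Carrier)
  actD ε (t , u) = (λ i → pick (ε i) (t i) (u i)) , (λ i → pick (ε i) (u i) (t i))
    where
    pick : Sign → Carrier → Carrier → Carrier
    pick Sign.+ x y = x
    pick Sign.- x y = y

  actW : W → (Fin n → Carrier) × (Fin n → Carrier)
       → (Fin n → Carrier) × (Fin n → Carrier)
  actW (ε , σ) x = actD ε (actS σ x)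

  -- permutation matrix: M_σ e_b = e_{σ(b)}
  Mσ : Permutation′ n → Fin n → Fin n → Carrier
  Mσ σ a b = δ (a Fin.≟ σ ⟨$⟩ʳ b)

  -- s(σ) = diag(M_σ, (1), J M_σ J) (block diagonal); in the lower block
  -- the entry at global (m-1-a, m-1-b) is (M_σ)_{a b}.
  sS : Permutation′ n → Mat m
  sS σ i j with pos m i | pos m j
  ... | upper a | upper b = Mσ σ a b
  ... | lower a | lower b = Mσ σ a b
  ... | middle  | middle  = 1#
  ... | _       | _       = 0#

  -- column swap i ↔ m+1-i (1-based) for each i with ε_i = -1
  swapε : (Fin n → Sign) → Fin m → Fin m
  swapε ε j with pos m j
  ... | upper a = flip (ε a)
    where flip : Sign → Fin m
          flip Sign.- = opposite j
          flip Sign.+ = j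
  ... | lower a = flip (ε a)
    where flip : Sign → Fin m
          flip Sign.- = opposite j
          flip Sign.+ = j
  ... | middle  = j

  swappedI : (Fin n → Sign) → Mat m
  swappedI ε i j = δ (i Fin.≟ swapε ε j)

  dε : (Fin n → Sign) → Mat m
  dε ε i j with pos m i | pos m j
  ... | middle | middle = neg1^ (countMinus ε)
  ... | _      | _      = swappedI ε i j

  s : W → Mat m
  s (ε , σ) = dε ε ⊗ sS σ

{-# OPTIONS --safe #-}
-- Every s(w) is a monomial matrix: its j-th column is c_j e_{ρ j}, where ρ is
-- the permutation of {1..m} induced by w acting on the positions (upper half,
-- lower half, middle) as a signed permutation, so that ρ commutes with
-- i ↦ m+1-i, and c_j = 1 except at the middle, where c_j = (-1)^#{i : ε_i = -1}.
-- Products of monomial matrices compose the permutations and multiply the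
-- coefficients along them; this gives the homomorphism property, the action
-- on the diagonal torus and s J sᵗ = J. Laplace expansion shows that a
-- monomial matrix has determinant (-1)^inv(ρ) ∏ c_j. Since ρ commutes with the
-- reversal, (a , b) ↦ (m+1-b , m+1-a) pairs up the inversions of ρ except those
-- of the form (a , m+1-a), whose number is #{i : ε_i = -1}. Hence
-- det s(w) = (-1)^#{ε_i = -1} ∏ c_j, which is 1: for odd m the middle entry
-- cancels the sign, for even m the number of -1's is even because ε ∈ D.

module Submission where

open import Defs
open import Algebra.Bundles using (CommutativeRing)
open import Data.Nat using (ℕ; _≤_)
open import Data.Product using (_×_; proj₁)
open import Algebra.Bundles using (CommutativeMonoid)
open import Data.Product using (_,_)
import Data.Nat as ℕ
import Data.Nat.Properties as ℕ

module FiniteSums {a ℓ} (M : CommutativeMonoid a ℓ) where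
  open import Data.Fin.Base using (Fin; suc; toℕ; punchIn; inject≤)
  open import Relation.Binary.PropositionalEquality using (_≢_)
  open CommutativeMonoid M renaming (ε to 0#; _∙_ to _+_; ∙-congˡ to +-congˡ)
  open import Algebra.Properties.CommutativeMonoid.Sum M using (sum; sum-remove; sum-cong-≋; sum-replicate-zero)
  open import Data.Fin.Properties using (punchInᵢ≢i)
  open import Relation.Binary.Reasoning.Setoid setoid

  sum-zeros : ∀ {k} {f : Fin k → Carrier} → (∀ i → f i ≈ 0#) → sum f ≈ 0#
  sum-zeros {k} f≈0 = trans (sum-cong-≋ f≈0) (sum-replicate-zero k)

  sum-single : ∀ {k} (f : Fin k → Carrier) (i : Fin k) → (∀ j → j ≢ i → f j ≈ 0#) → sum f ≈ f i
  sum-single {ℕ.suc k} f i f≈0 = begin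
    sum f                              ≈⟨ sum-remove {i = i} f ⟩
    f i + sum (λ j → f (punchIn i j))  ≈⟨ +-congˡ (sum-zeros (λ j → f≈0 _ (punchInᵢ≢i i j))) ⟩
    f i + 0#                           ≈⟨ identityʳ _ ⟩
    f i                                ∎

  sum-inject≤ : ∀ {k l} (l≤k : l ℕ.≤ k) (f : Fin k → Carrier) → (∀ i → l ℕ.≤ toℕ i → f i ≈ 0#) →
                sum f ≈ sum (λ i → f (inject≤ i l≤k))
  sum-inject≤ {l = ℕ.zero}  _           f f≈0 = sum-zeros (λ i → f≈0 i ℕ.z≤n)
  sum-inject≤ {l = ℕ.suc l} (ℕ.s≤s l≤k) f f≈0 =
    +-congˡ (sum-inject≤ l≤k (λ i → f (suc i)) (λ i l≤i → f≈0 (suc i) (ℕ.s≤s l≤i)))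

module Parity where
  open import Data.Nat.Base using (ℕ; zero; suc; _+_; _/_; _%_; s≤s)
  open import Data.Nat.Properties using (*-comm; +-identityʳ; ≤⇒≯)
  open import Data.Nat.DivMod using (m≡m%n+[m/n]*n; m%n<n)
  open import Data.Product using (_×_; _,_)
  open import Data.Sum using (_⊎_; inj₁; inj₂)
  open import Data.Empty using (⊥-elim)
  open import Relation.Binary.PropositionalEquality

  halves : ∀ a → a ≡ a % 2 + (a / 2 + a / 2)
  halves a = trans (m≡m%n+[m/n]*n a 2) (cong (a % 2 +_) (trans (*-comm (a / 2) 2) (cong (a / 2 +_) (+-identityʳ (a / 2)))))

  even-or-odd : ∀ a → (a % 2 ≡ 0 × a ≡ a / 2 + a / 2) ⊎ a ≡ suc (a / 2 + a / 2)
  even-or-odd a with a % 2 in r | halves a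
  ... | zero        | a≡ = inj₁ (refl , a≡)
  ... | suc zero    | a≡ = inj₂ a≡
  ... | suc (suc _) | _  = ⊥-elim (≤⇒≯ (s≤s (s≤s ℕ.z≤n)) (subst (ℕ._< 2) r (m%n<n a 2)))

module Inversions where
  open import Data.Nat.Base using (ℕ; zero; suc; _+_; z<s; s<s)
  open import Data.Fin.Base using (Fin; zero; suc; toℕ; opposite; punchIn; _<_)
  open import Data.Fin.Properties
    using (_<?_; _≟_; <-cmp; punchIn-mono-≤; punchIn-cancel-≤; opposite-prop; opposite-involutive; toℕ<n)
  open import Data.Fin.Permutation as Perm using (Permutation′; _⟨$⟩ʳ_; _⟨$⟩ˡ_)
  open import Data.Product using (_×_; _,_; proj₁; proj₂; ∃)
  open import Data.Empty using (⊥-elim)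
  open import Data.Sign.Base as Sign using (Sign)
  import Data.Sign.Properties as Sign
  open import Function using (_∘_)
  open import Relation.Nullary using (Dec; yes; no; ¬_; _×-dec_)
  open import Relation.Binary.Definitions using (tri<; tri≈; tri>)
  open import Relation.Binary.PropositionalEquality
  open import Algebra.Properties.CommutativeMonoid.Sum ℕ.+-0-commutativeMonoid
    using (sum; sum-remove; ∑-comm; ∑-distrib-+; sum-permute; sum-cong-≗)
  open FiniteSums ℕ.+-0-commutativeMonoid using (sum-zeros; sum-single)

  𝟙 : ∀ {p} {P : Set p} → Dec P → ℕ
  𝟙 (yes _) = 1
  𝟙 (no _)  = 0

  𝟙-yes : ∀ {p} {P : Set p} (d : Dec P) → P → 𝟙 d ≡ 1
  𝟙-yes (yes _) _  = refl
  𝟙-yes (no ¬p) p = ⊥-elim (¬p p)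

  𝟙-no : ∀ {p} {P : Set p} (d : Dec P) → ¬ P → 𝟙 d ≡ 0
  𝟙-no (yes p) ¬p = ⊥-elim (¬p p)
  𝟙-no (no _)  _  = refl

  𝟙-cong : ∀ {p q} {P : Set p} {Q : Set q} (d : Dec P) (e : Dec Q) → (P → Q) → (Q → P) → 𝟙 d ≡ 𝟙 e
  𝟙-cong (yes p) e to from = sym (𝟙-yes e (to p))
  𝟙-cong (no ¬p) e to from = sym (𝟙-no e (¬p ∘ from))

  countMinus≡∑ : ∀ {k} (ε : Fin k → Sign) → countMinus ε ≡ sum (λ i → 𝟙 (ε i Sign.≟ Sign.-))
  countMinus≡∑ {zero}  ε = refl
  countMinus≡∑ {suc k} ε with ε zero
  ... | Sign.- = cong suc (countMinus≡∑ (λ i → ε (suc i)))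
  ... | Sign.+ = countMinus≡∑ (λ i → ε (suc i))

  𝟙-trichotomy : ∀ {p k} {P : Set p} (d : Dec P) (x y : Fin k) →
                 𝟙 d ≡ 𝟙 (d ×-dec x <? y) + 𝟙 (d ×-dec y <? x) + 𝟙 (d ×-dec x ≟ y)
  𝟙-trichotomy (no ¬p) x y
    rewrite 𝟙-no (no ¬p ×-dec x <? y) (¬p ∘ proj₁)
          | 𝟙-no (no ¬p ×-dec y <? x) (¬p ∘ proj₁)
          | 𝟙-no (no ¬p ×-dec x ≟ y) (¬p ∘ proj₁) = refl
  𝟙-trichotomy (yes p) x y with <-cmp x y
  ... | tri< x<y x≢y x≯y
    rewrite 𝟙-yes (yes p ×-dec x <? y) (p , x<y)
          | 𝟙-no (yes p ×-dec y <? x) (x≯y ∘ proj₂)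
          | 𝟙-no (yes p ×-dec x ≟ y) (x≢y ∘ proj₂) = refl
  ... | tri≈ x≮y x≡y x≯y
    rewrite 𝟙-no (yes p ×-dec x <? y) (x≮y ∘ proj₂)
          | 𝟙-no (yes p ×-dec y <? x) (x≯y ∘ proj₂)
          | 𝟙-yes (yes p ×-dec x ≟ y) (p , x≡y) = refl
  ... | tri> x≮y x≢y x>y
    rewrite 𝟙-no (yes p ×-dec x <? y) (x≮y ∘ proj₂)
          | 𝟙-yes (yes p ×-dec y <? x) (p , x>y)
          | 𝟙-no (yes p ×-dec x ≟ y) (x≢y ∘ proj₂) = refl

  count-< : ∀ {k} (j : Fin (suc k)) → sum (λ (i : Fin k) → 𝟙 (i <? j)) ≡ toℕ j
  count-< {k} zero        = sum-zeros {k} (λ i → 𝟙-no (i <? zero {k}) λ ())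
  count-< {suc k} (suc j) = cong₂ _+_ (𝟙-yes (zero {k} <? suc j) z<s)
    (trans (sum-cong-≗ {k} λ i → 𝟙-cong (suc i <? suc j) (i <? j) ℕ.s<s⁻¹ s<s) (count-< j))

  punchIn-mono-< : ∀ {k} (i : Fin (suc k)) {a b : Fin k} → a < b → punchIn i a < punchIn i b
  punchIn-mono-< i {a} {b} a<b = ℕ.≰⇒> λ b′≤a′ → ℕ.<⇒≱ a<b (punchIn-cancel-≤ i b a b′≤a′)

  punchIn-cancel-< : ∀ {k} (i : Fin (suc k)) {a b : Fin k} → punchIn i a < punchIn i b → a < b
  punchIn-cancel-< i {a} {b} a′<b′ = ℕ.≰⇒> λ b≤a → ℕ.<⇒≱ a′<b′ (punchIn-mono-≤ i b a b≤a)

  punchIn-<-pivot : ∀ {k} (j : Fin (suc k)) (i : Fin k) → punchIn j i < j → i < j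
  punchIn-<-pivot (suc j) zero    _   = z<s
  punchIn-<-pivot (suc j) (suc i) i<j = s<s (punchIn-<-pivot j i (ℕ.s<s⁻¹ i<j))

  <-pivot-punchIn : ∀ {k} (j : Fin (suc k)) (i : Fin k) → i < j → punchIn j i < j
  <-pivot-punchIn (suc j) zero    _   = z<s
  <-pivot-punchIn (suc j) (suc i) i<j = s<s (<-pivot-punchIn j i (ℕ.s<s⁻¹ i<j))

  opposite-reverses-< : ∀ {k} {a b : Fin k} → a < b → opposite b < opposite a
  opposite-reverses-< {k} {a} {b} a<b
    rewrite opposite-prop a | opposite-prop b = ℕ.∸-monoʳ-< (s<s a<b) (toℕ<n b)

  Inverted : ∀ {k} → (Fin k → Fin k) → Fin k → Fin k → Set
  Inverted f a b = a < b × f b < f a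

  inverted? : ∀ {k} (f : Fin k → Fin k) a b → Dec (Inverted f a b)
  inverted? f a b = a <? b ×-dec f b <? f a

  inversions : ∀ {k} → (Fin k → Fin k) → ℕ
  inversions f = sum λ a → sum λ b → 𝟙 (inverted? f a b)

  crossings : ∀ {k} → (Fin k → Fin k) → ℕ
  crossings f = sum λ a → 𝟙 (inverted? f a (opposite a))

  module _ {k} (π : Permutation′ (suc k)) where
    private
      f : Fin (suc k) → Fin (suc k)
      f = π ⟨$⟩ʳ_
      j₀ : Fin (suc k)
      j₀ = π ⟨$⟩ˡ zero
      f′ : Fin k → Fin k
      f′ = Perm.remove j₀ π ⟨$⟩ʳ_

      f-j₀ : f j₀ ≡ zero
      f-j₀ = Perm.inverseʳ π

      f-punchIn : ∀ i → f (punchIn j₀ i) ≡ suc (f′ i)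
      f-punchIn = Perm.punchIn-permute′ π zero

      row-j₀ : ∀ b → ¬ Inverted f j₀ b
      row-j₀ b (_ , fb<f₀) = ℕ.n≮0 (subst (λ x → f b < x) f-j₀ fb<f₀)

      column-j₀ : ∀ i → Inverted f (punchIn j₀ i) j₀ → i < j₀
      column-j₀ i (i′<j₀ , _) = punchIn-<-pivot j₀ i i′<j₀

      column-j₀⁻¹ : ∀ i → i < j₀ → Inverted f (punchIn j₀ i) j₀
      column-j₀⁻¹ i i<j₀ = <-pivot-punchIn j₀ i i<j₀ ,
        subst₂ _<_ (sym f-j₀) (sym (f-punchIn i)) z<s

      minor : ∀ i j → Inverted f (punchIn j₀ i) (punchIn j₀ j) → Inverted f′ i j
      minor i j (i′<j′ , fj′<fi′) =
        punchIn-cancel-< j₀ i′<j′ , ℕ.s<s⁻¹ (subst₂ _<_ (f-punchIn j) (f-punchIn i) fj′<fi′)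

      minor⁻¹ : ∀ i j → Inverted f′ i j → Inverted f (punchIn j₀ i) (punchIn j₀ j)
      minor⁻¹ i j (i<j , fj<fi) =
        punchIn-mono-< j₀ i<j , subst₂ _<_ (sym (f-punchIn j)) (sym (f-punchIn i)) (s<s fj<fi)

    inversions-remove : inversions (π ⟨$⟩ʳ_) ≡ toℕ (π ⟨$⟩ˡ zero) + inversions (Perm.remove (π ⟨$⟩ˡ zero) π ⟨$⟩ʳ_)
    inversions-remove = begin
      inversions f
        ≡⟨ sum-remove {i = j₀} (λ a → sum λ b → 𝟙 (inverted? f a b)) ⟩
      sum (λ b → 𝟙 (inverted? f j₀ b)) + sum (λ (i : Fin k) → sum λ b → 𝟙 (inverted? f (punchIn j₀ i) b))
        ≡⟨ cong₂ _+_ (sum-zeros (λ b → 𝟙-no (inverted? f j₀ b) (row-j₀ b)))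
                     (sum-cong-≗ λ i → sum-remove {i = j₀} (λ b → 𝟙 (inverted? f (punchIn j₀ i) b))) ⟩
      sum (λ (i : Fin k) → 𝟙 (inverted? f (punchIn j₀ i) j₀)
                 + sum λ j → 𝟙 (inverted? f (punchIn j₀ i) (punchIn j₀ j)))
        ≡⟨ sum-cong-≗ (λ i → cong₂ _+_
             (𝟙-cong (inverted? f _ j₀) (i <? j₀) (column-j₀ i) (column-j₀⁻¹ i))
             (sum-cong-≗ λ j → 𝟙-cong (inverted? f _ _) (inverted? f′ i j) (minor i j) (minor⁻¹ i j))) ⟩
      sum (λ (i : Fin k) → 𝟙 (i <? j₀) + sum λ j → 𝟙 (inverted? f′ i j))
        ≡⟨ ∑-distrib-+ (λ (i : Fin k) → 𝟙 (i <? j₀)) _ ⟩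
      sum (λ (i : Fin k) → 𝟙 (i <? j₀)) + inversions f′
        ≡⟨ cong (_+ inversions f′) (count-< j₀) ⟩
      toℕ j₀ + inversions f′ ∎
      where open ≡-Reasoning

  module _ {k} (f : Fin k → Fin k) (f-opposite : ∀ a → f (opposite a) ≡ opposite (f a)) where
    private
      before after across : Fin k → Fin k → ℕ
      before a b = 𝟙 (inverted? f a b ×-dec a <? opposite b)
      after  a b = 𝟙 (inverted? f a b ×-dec opposite b <? a)
      across a b = 𝟙 (inverted? f a b ×-dec a ≟ opposite b)

      mirror : ∀ {a b} → Inverted f a b → Inverted f (opposite b) (opposite a)
      mirror {a} {b} (a<b , fb<fa) = opposite-reverses-< a<b ,
        subst₂ _<_ (sym (f-opposite a)) (sym (f-opposite b)) (opposite-reverses-< fb<fa)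

      mirror⁻¹ : ∀ {a b} → Inverted f (opposite b) (opposite a) → Inverted f a b
      mirror⁻¹ {a} {b} p = subst₂ (Inverted f) (opposite-involutive a) (opposite-involutive b) (mirror p)

      after≡before-mirrored : ∀ a b → after a b ≡ before (opposite b) (opposite a)
      after≡before-mirrored a b = 𝟙-cong (inverted? f a b ×-dec opposite b <? a) (inverted? f _ _ ×-dec _ <? _)
        (λ (p , b′<a) → mirror p , subst (opposite b <_) (sym (opposite-involutive a)) b′<a)
        (λ (p , b′<a) → mirror⁻¹ p , subst (opposite b <_) (opposite-involutive a) b′<a)

      ∑after≡∑before : sum (λ a → sum (after a)) ≡ sum (λ a → sum (before a))
      ∑after≡∑before = begin
        sum (λ a → sum λ b → after a b)
          ≡⟨ sum-cong-≗ (λ a → sum-cong-≗ (after≡before-mirrored a)) ⟩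
        sum (λ a → sum λ b → before (opposite b) (opposite a))
          ≡⟨ sum-cong-≗ (λ a → sum-permute (λ b → before b (opposite a)) Perm.reverse) ⟨
        sum (λ a → sum λ b → before b (opposite a))
          ≡⟨ sum-permute (λ a → sum λ b → before b a) Perm.reverse ⟨
        sum (λ a → sum λ b → before b a)
          ≡⟨ ∑-comm (λ a b → before b a) ⟩
        sum (λ b → sum λ a → before b a) ∎
        where open ≡-Reasoning

      ∑across : ∀ a → sum (across a) ≡ 𝟙 (inverted? f a (opposite a))
      ∑across a = trans (sum-single (across a) (opposite a) off-diagonal) on-diagonal
        where
        off-diagonal : ∀ b → b ≢ opposite a → across a b ≡ 0
        off-diagonal b b≢a′ = 𝟙-no (inverted? f a b ×-dec a ≟ opposite b)
          λ (_ , a≡b′) → b≢a′ (trans (sym (opposite-involutive b)) (cong opposite (sym a≡b′)))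
        on-diagonal : across a (opposite a) ≡ 𝟙 (inverted? f a (opposite a))
        on-diagonal = 𝟙-cong (inverted? f a (opposite a) ×-dec _ ≟ _) (inverted? f a (opposite a))
          proj₁ (λ p → p , sym (opposite-involutive a))

    -- (a , b) ↦ (opposite b , opposite a) exchanges the inversions with a before and after
    -- opposite b; those with a = opposite b are the crossings.
    inversions≡double+crossings : ∃ λ y → inversions f ≡ y + y + crossings f
    inversions≡double+crossings = y , (begin
      inversions f
        ≡⟨ sum-cong-≗ (λ a → sum-cong-≗ λ b → 𝟙-trichotomy (inverted? f a b) a (opposite b)) ⟩
      sum (λ a → sum λ b → before a b + after a b + across a b)
        ≡⟨ sum-cong-≗ (λ a → trans (∑-distrib-+ (λ b → before a b + after a b) (across a))
                                   (cong (_+ sum (across a)) (∑-distrib-+ (before a) (after a)))) ⟩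
      sum (λ a → sum (before a) + sum (after a) + sum (across a))
        ≡⟨ trans (∑-distrib-+ (λ a → sum (before a) + sum (after a)) (λ a → sum (across a)))
                 (cong (_+ sum (λ a → sum (across a))) (∑-distrib-+ (λ a → sum (before a)) (λ a → sum (after a)))) ⟩
      y + sum (λ a → sum (after a)) + sum (λ a → sum (across a))
        ≡⟨ cong₂ _+_ (cong (y +_) ∑after≡∑before) (sum-cong-≗ ∑across) ⟩
      y + y + crossings f ∎)
      where
      open ≡-Reasoning
      y : ℕ
      y = sum λ a → sum (before a)

module Signs {c ℓ} (R : CommutativeRing c ℓ) (m : ℕ) where
  open CommutativeRing R hiding (zero)
  open SO R m using (neg1^)
  open import Data.Nat.Base using (zero; suc)
  open import Data.Fin.Base using (Fin; zero; suc)
  open import Data.Fin.Permutation as Perm using (Permutation′; _⟨$⟩ˡ_)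
  open import Data.Sign.Base as Sign using (Sign)
  open import Data.Sign.Properties using (_≟_)
  open import Relation.Binary.PropositionalEquality as ≡ using (_≡_)
  open import Algebra.Properties.Ring ring using (-‿distribˡ-*; -‿distribʳ-*; -‿involutive)
  open import Algebra.Properties.CommutativeMonoid.Sum *-commutativeMonoid as Π using () renaming (sum to ∏)
  import Algebra.Properties.CommutativeMonoid.Sum ℕ.+-0-commutativeMonoid as ℕΣ
  open import Relation.Binary.Reasoning.Setoid setoid
  open Inversions using (𝟙; countMinus≡∑)

  neg1^-+ : ∀ a b → neg1^ (a ℕ.+ b) ≈ neg1^ a * neg1^ b
  neg1^-+ zero    b = sym (*-identityˡ _)
  neg1^-+ (suc a) b = trans (-‿cong (neg1^-+ a b)) (-‿distribˡ-* _ _)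

  neg1^-square : ∀ a → neg1^ a * neg1^ a ≈ 1#
  neg1^-square zero    = *-identityˡ 1#
  neg1^-square (suc a) = begin
    - neg1^ a * - neg1^ a     ≈⟨ -‿distribˡ-* _ _ ⟨
    - (neg1^ a * - neg1^ a)   ≈⟨ -‿cong (-‿distribʳ-* _ _) ⟨
    - - (neg1^ a * neg1^ a)   ≈⟨ -‿involutive _ ⟩
    neg1^ a * neg1^ a         ≈⟨ neg1^-square a ⟩
    1#                        ∎

  neg1^-double : ∀ a → neg1^ (a ℕ.+ a) ≈ 1#
  neg1^-double a = trans (neg1^-+ a a) (neg1^-square a)

  neg1^-∑ : ∀ {k} (f : Fin k → ℕ.ℕ) → neg1^ (ℕΣ.sum f) ≈ ∏ (λ i → neg1^ (f i))
  neg1^-∑ {zero}  f = refl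
  neg1^-∑ {suc k} f = trans (neg1^-+ (f zero) _) (*-congˡ (neg1^-∑ (λ i → f (suc i))))

  neg1^-even : ∀ a → a ℕ.% 2 ≡ 0 → neg1^ a ≈ 1#
  neg1^-even a a%2≡0 = trans (reflexive (≡.cong neg1^ a≡2[a/2])) (neg1^-double (a ℕ./ 2))
    where
    a≡2[a/2] : a ≡ a ℕ./ 2 ℕ.+ a ℕ./ 2
    a≡2[a/2] = ≡.trans (Parity.halves a) (≡.cong (ℕ._+ (a ℕ./ 2 ℕ.+ a ℕ./ 2)) a%2≡0)

  sgn : Sign → Carrier
  sgn s = neg1^ (𝟙 (s ≟ Sign.-))

  sgn-* : ∀ s t → sgn (s Sign.* t) ≈ sgn s * sgn t
  sgn-* Sign.+ t      = sym (*-identityˡ _)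
  sgn-* Sign.- Sign.+ = sym (*-identityʳ _)
  sgn-* Sign.- Sign.- = sym (neg1^-square 1)

  neg1^-countMinus : ∀ {k} (ε : Fin k → Sign) → neg1^ (countMinus ε) ≈ ∏ (λ i → sgn (ε i))
  neg1^-countMinus ε = trans (reflexive (≡.cong neg1^ (countMinus≡∑ ε))) (neg1^-∑ (λ i → 𝟙 (ε i ≟ Sign.-)))

  neg1^-countMinus-· : ∀ {k} (ε ε′ : Fin k → Sign) (σ : Permutation′ k) →
    neg1^ (countMinus (λ i → ε i Sign.* ε′ (σ ⟨$⟩ˡ i))) ≈ neg1^ (countMinus ε) * neg1^ (countMinus ε′)
  neg1^-countMinus-· ε ε′ σ = begin
    neg1^ (countMinus (λ i → ε i Sign.* ε′ (σ ⟨$⟩ˡ i)))  ≈⟨ neg1^-countMinus (λ i → ε i Sign.* ε′ (σ ⟨$⟩ˡ i)) ⟩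
    ∏ (λ i → sgn (ε i Sign.* ε′ (σ ⟨$⟩ˡ i)))             ≈⟨ Π.sum-cong-≋ (λ i → sgn-* (ε i) _) ⟩
    ∏ (λ i → sgn (ε i) * sgn (ε′ (σ ⟨$⟩ˡ i)))            ≈⟨ Π.∑-distrib-+ (λ i → sgn (ε i)) (λ i → sgn (ε′ (σ ⟨$⟩ˡ i))) ⟩
    ∏ (λ i → sgn (ε i)) * ∏ (λ i → sgn (ε′ (σ ⟨$⟩ˡ i)))  ≈⟨ *-congˡ (Π.sum-permute (λ i → sgn (ε′ i)) (Perm.flip σ)) ⟨
    ∏ (λ i → sgn (ε i)) * ∏ (λ i → sgn (ε′ i))           ≈⟨ *-cong (neg1^-countMinus ε) (neg1^-countMinus ε′) ⟨
    neg1^ (countMinus ε) * neg1^ (countMinus ε′)         ∎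

module MonomialMatrices {c ℓ} (R : CommutativeRing c ℓ) (m : ℕ) where
  open CommutativeRing R hiding (zero)
  open SO R m using (Mat; sumF; _⊗_; _≈M_; ᵗ; δ; neg1^; det)
  open import Data.Nat.Base using (zero; suc)
  open import Data.Fin.Base using (Fin; zero; suc; toℕ; punchIn)
  import Data.Fin.Properties as Fin
  open import Data.Fin.Permutation as Perm using (Permutation′; _⟨$⟩ʳ_; _⟨$⟩ˡ_)
  open import Data.Empty using (⊥-elim)
  open import Relation.Nullary using (Dec; yes; no; ¬_)
  open import Relation.Binary.PropositionalEquality as ≡ using (_≡_; _≢_)
  open import Relation.Binary.Bundles using (Setoid)
  open import Algebra.Properties.CommutativeSemigroup *-commutativeSemigroup using (interchange)
  open import Algebra.Properties.CommutativeMonoid.Sum +-commutativeMonoid as Σ using ()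
  open import Algebra.Properties.CommutativeMonoid.Sum *-commutativeMonoid as Π using () renaming (sum to ∏)
  open FiniteSums +-commutativeMonoid using (sum-single)
  open Inversions using (inversions; inversions-remove)
  open Signs R m using (neg1^-+)
  import Relation.Binary.Reasoning.Setoid

  module ≈-Reasoning = Relation.Binary.Reasoning.Setoid setoid

  sumF≡sum : ∀ k f → sumF k f ≡ Σ.sum f
  sumF≡sum zero    f = ≡.refl
  sumF≡sum (suc k) f = ≡.cong (f zero +_) (sumF≡sum k (λ i → f (suc i)))

  sumF-cong : ∀ k {f g : Fin k → Carrier} → (∀ i → f i ≈ g i) → sumF k f ≈ sumF k g
  sumF-cong zero    f≈g = refl
  sumF-cong (suc k) f≈g = +-cong (f≈g zero) (sumF-cong k (λ i → f≈g (suc i)))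

  sumF-single : ∀ k (f : Fin k → Carrier) (i : Fin k) → (∀ j → j ≢ i → f j ≈ 0#) → sumF k f ≈ f i
  sumF-single k f i f≈0 = trans (reflexive (sumF≡sum k f)) (sum-single f i f≈0)

  ≈M-setoid : ℕ.ℕ → Setoid c ℓ
  ≈M-setoid k = record
    { Carrier = Mat k
    ; _≈_ = _≈M_
    ; isEquivalence = record
      { refl  = λ i j → refl
      ; sym   = λ A≈B i j → sym (A≈B i j)
      ; trans = λ A≈B B≈C i j → trans (A≈B i j) (B≈C i j) } }

  module ≈M-Reasoning (k : ℕ.ℕ) = Relation.Binary.Reasoning.Setoid (≈M-setoid k)

  ⊗-cong : ∀ {k} {A A′ B B′ : Mat k} → A ≈M A′ → B ≈M B′ → A ⊗ B ≈M A′ ⊗ B′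
  ⊗-cong {k} A≈A′ B≈B′ i j = sumF-cong k (λ l → *-cong (A≈A′ i l) (B≈B′ l j))

  ᵗ-cong : ∀ {k} {A B : Mat k} → A ≈M B → ᵗ A ≈M ᵗ B
  ᵗ-cong A≈B i j = A≈B j i

  module _ {a} {P : Set a} where

    δ-yes : (d : Dec P) → P → δ d ≈ 1#
    δ-yes (yes _) _ = refl
    δ-yes (no ¬p) p = ⊥-elim (¬p p)

    δ-no : (d : Dec P) → ¬ P → δ d ≈ 0#
    δ-no (yes p) ¬p = ⊥-elim (¬p p)
    δ-no (no _)  _  = refl

  δ-cong : ∀ {a b} {P : Set a} {Q : Set b} (d : Dec P) (e : Dec Q) → (P → Q) → (Q → P) → δ d ≈ δ e
  δ-cong (yes p) e to from = sym (δ-yes e (to p))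
  δ-cong (no ¬p) e to from = sym (δ-no e (λ q → ¬p (from q)))

  monomial : ∀ {k} → (Fin k → Fin k) → (Fin k → Carrier) → Mat k
  monomial π c i j = δ (i Fin.≟ π j) * c j

  monomial-cong : ∀ {k} {π π′ : Fin k → Fin k} {c c′ : Fin k → Carrier} →
                  (∀ j → π j ≡ π′ j) → (∀ j → c j ≈ c′ j) → monomial π c ≈M monomial π′ c′
  monomial-cong {π = π} {π′} π≡π′ c≈c′ i j = *-cong
    (δ-cong (i Fin.≟ π j) (i Fin.≟ π′ j) (λ e → ≡.trans e (π≡π′ j)) (λ e → ≡.trans e (≡.sym (π≡π′ j))))
    (c≈c′ j)

  monomial-⊗ : ∀ {k} (π ρ : Fin k → Fin k) (c d : Fin k → Carrier) →
               monomial π c ⊗ monomial ρ d ≈M monomial (λ j → π (ρ j)) (λ j → c (ρ j) * d j)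
  monomial-⊗ {k} π ρ c d i j = begin
    sumF k (λ l → δ (i Fin.≟ π l) * c l * (δ (l Fin.≟ ρ j) * d j))
      ≈⟨ sumF-single k _ (ρ j) (λ l l≢ρj →
           trans (*-congˡ (trans (*-congʳ (δ-no (l Fin.≟ ρ j) l≢ρj)) (zeroˡ _))) (zeroʳ _)) ⟩
    δ (i Fin.≟ π (ρ j)) * c (ρ j) * (δ (ρ j Fin.≟ ρ j) * d j)
      ≈⟨ *-congˡ (trans (*-congʳ (δ-yes (ρ j Fin.≟ ρ j) ≡.refl)) (*-identityˡ _)) ⟩
    δ (i Fin.≟ π (ρ j)) * c (ρ j) * d j
      ≈⟨ *-assoc _ _ _ ⟩
    δ (i Fin.≟ π (ρ j)) * (c (ρ j) * d j) ∎
    where open ≈-Reasoning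

  ᵗ-monomial : ∀ {k} (π π⁻¹ : Fin k → Fin k) (c : Fin k → Carrier) →
               (∀ x → π⁻¹ (π x) ≡ x) → (∀ y → π (π⁻¹ y) ≡ y) →
               ᵗ (monomial π c) ≈M monomial π⁻¹ (λ j → c (π⁻¹ j))
  ᵗ-monomial π π⁻¹ c left right i j with i Fin.≟ π⁻¹ j
  ... | yes i≡ = *-cong (δ-yes (j Fin.≟ π i) (≡.trans (≡.sym (right j)) (≡.cong π (≡.sym i≡))))
                        (reflexive (≡.cong c i≡))
  ... | no  i≢ = trans (*-congʳ (δ-no (j Fin.≟ π i) λ j≡ → i≢ (≡.trans (≡.sym (left i)) (≡.cong π⁻¹ (≡.sym j≡)))))
                       (trans (zeroˡ _) (sym (zeroˡ _)))

  det-cong : ∀ k {A B : Mat k} → A ≈M B → det k A ≈ det k B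
  det-cong zero    A≈B = refl
  det-cong (suc k) A≈B = sumF-cong (suc k) λ j →
    *-cong (*-congˡ {neg1^ (toℕ j)} (A≈B zero j)) (det-cong k (λ r s → A≈B (suc r) (punchIn j s)))

  det-monomial : ∀ k (π : Permutation′ k) (c : Fin k → Carrier) →
                 det k (monomial (π ⟨$⟩ʳ_) c) ≈ neg1^ (inversions (π ⟨$⟩ʳ_)) * ∏ c
  det-monomial zero    π c = sym (*-identityʳ 1#)
  det-monomial (suc k) π c = begin
    det (suc k) A
      ≈⟨ sumF-single (suc k) _ j₀ off-column ⟩
    neg1^ (toℕ j₀) * A zero j₀ * det k (minor j₀)
      ≈⟨ *-cong (*-congˡ first-row) (trans (det-cong k minor-monomial) (det-monomial k π′ c′)) ⟩
    neg1^ (toℕ j₀) * c j₀ * (neg1^ (inversions f′) * ∏ c′)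
      ≈⟨ interchange _ _ _ _ ⟩
    neg1^ (toℕ j₀) * neg1^ (inversions f′) * (c j₀ * ∏ c′)
      ≈⟨ *-cong (neg1^-+ (toℕ j₀) (inversions f′)) (Π.sum-remove {i = j₀} c) ⟨
    neg1^ (toℕ j₀ ℕ.+ inversions f′) * ∏ c
      ≡⟨ ≡.cong (λ e → neg1^ e * ∏ c) (inversions-remove π) ⟨
    neg1^ (inversions f) * ∏ c ∎
    where
    open ≈-Reasoning
    f : Fin (suc k) → Fin (suc k)
    f = π ⟨$⟩ʳ_
    A : Mat (suc k)
    A = monomial f c
    j₀ : Fin (suc k)
    j₀ = π ⟨$⟩ˡ zero
    π′ : Permutation′ k
    π′ = Perm.remove j₀ π
    f′ : Fin k → Fin k
    f′ = π′ ⟨$⟩ʳ_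
    c′ : Fin k → Carrier
    c′ s = c (punchIn j₀ s)
    minor : Fin (suc k) → Mat k
    minor j r s = A (suc r) (punchIn j s)
    f-j₀ : f j₀ ≡ zero
    f-j₀ = Perm.inverseʳ π
    f-punchIn : ∀ s → f (punchIn j₀ s) ≡ suc (f′ s)
    f-punchIn = Perm.punchIn-permute′ π zero
    off-column : ∀ j → j ≢ j₀ → neg1^ (toℕ j) * A zero j * det k (minor j) ≈ 0#
    off-column j j≢j₀ = begin
      neg1^ (toℕ j) * (δ (zero Fin.≟ f j) * c j) * det k (minor j)
        ≈⟨ *-congʳ (*-congˡ (*-congʳ (δ-no (zero Fin.≟ f j) λ 0≡fj →
             j≢j₀ (≡.trans (≡.sym (Perm.inverseˡ π)) (≡.cong (π ⟨$⟩ˡ_) (≡.sym 0≡fj)))))) ⟩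
      neg1^ (toℕ j) * (0# * c j) * det k (minor j)
        ≈⟨ trans (*-congʳ (trans (*-congˡ (zeroˡ _)) (zeroʳ _))) (zeroˡ _) ⟩
      0# ∎
    first-row : A zero j₀ ≈ c j₀
    first-row = trans (*-congʳ (δ-yes (zero Fin.≟ f j₀) (≡.sym f-j₀))) (*-identityˡ _)
    minor-monomial : minor j₀ ≈M monomial f′ c′
    minor-monomial r s = *-congʳ (δ-cong (suc r Fin.≟ f (punchIn j₀ s)) (r Fin.≟ f′ s)
      (λ e → Fin.suc-injective (≡.trans e (f-punchIn s)))
      (λ e → ≡.trans (≡.cong suc e) (≡.sym (f-punchIn s))))

module SignedPermutations (n : ℕ) where
  open import Data.Fin.Base using (Fin)
  open import Data.Sign.Properties using (_≟_)
  import Data.Fin.Properties as Fin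
  import Relation.Nullary.Decidable as Dec
  open import Relation.Binary.Definitions using (DecidableEquality)
  open import Data.Fin.Permutation as Perm using (Permutation′; _⟨$⟩ʳ_; _⟨$⟩ˡ_)
  open import Data.Sign.Base as Sign using (Sign)
  open import Data.Unit using (⊤)
  open import Data.Empty using (⊥)
  open import Relation.Nullary using (Dec; yes; no)
  open import Relation.Binary.PropositionalEquality
  open import Data.Nat.Properties using (+-0-commutativeMonoid)
  import Algebra.Properties.CommutativeMonoid.Sum +-0-commutativeMonoid as ∑
  open Inversions using (𝟙; 𝟙-cong; countMinus≡∑)

  mirror : Pos n → Pos n
  mirror (upper a) = lower a
  mirror (lower a) = upper a
  mirror middle    = middle

  mirror-involutive : ∀ p → mirror (mirror p) ≡ p
  mirror-involutive (upper a) = refl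
  mirror-involutive (lower a) = refl
  mirror-involutive middle    = refl

  mirror-fixed : ∀ {p} → mirror p ≡ p → p ≡ middle
  mirror-fixed {middle} _ = refl

  IsUpper IsLower : Pos n → Set
  IsUpper (upper _) = ⊤
  IsUpper _         = ⊥
  IsLower p = IsUpper (mirror p)

  isUpper? : ∀ p → Dec (IsUpper p)
  isUpper? (upper _) = yes _
  isUpper? (lower _) = no λ ()
  isUpper? middle    = no λ ()

  isLower? : ∀ p → Dec (IsLower p)
  isLower? p = isUpper? (mirror p)

  upper-injective : ∀ {a b} → upper a ≡ upper {n} b → a ≡ b
  upper-injective refl = refl

  lower-injective : ∀ {a b} → lower a ≡ lower {n} b → a ≡ b
  lower-injective refl = refl

  _≟ₚ_ : DecidableEquality (Pos n)
  upper a ≟ₚ upper b = Dec.map′ (cong upper) upper-injective (a Fin.≟ b)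
  lower a ≟ₚ lower b = Dec.map′ (cong lower) lower-injective (a Fin.≟ b)
  middle  ≟ₚ middle  = yes refl
  upper _ ≟ₚ lower _ = no λ ()
  upper _ ≟ₚ middle  = no λ ()
  lower _ ≟ₚ upper _ = no λ ()
  lower _ ≟ₚ middle  = no λ ()
  middle  ≟ₚ upper _ = no λ ()
  middle  ≟ₚ lower _ = no λ ()

  record SignedPermutation : Set where
    field
      to from   : Pos n → Pos n
      from-to   : ∀ p → from (to p) ≡ p
      to-from   : ∀ p → to (from p) ≡ p
      to-mirror : ∀ p → to (mirror p) ≡ mirror (to p)

    to-middle : to middle ≡ middle
    to-middle = mirror-fixed (sym (to-mirror middle))

    to≡middle : ∀ {p} → to p ≡ middle → p ≡ middle
    to≡middle {p} e = trans (sym (from-to p)) (trans (cong from (trans e (sym to-middle))) (from-to middle))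

    from≡middle : ∀ {p} → from p ≡ middle → p ≡ middle
    from≡middle {p} e = trans (sym (to-from p)) (trans (cong to e) to-middle)


  open SignedPermutation using (to)

  infixr 9 _∘ₛ_
  _∘ₛ_ : SignedPermutation → SignedPermutation → SignedPermutation
  P ∘ₛ Q = record
    { to        = λ p → P.to (Q.to p)
    ; from      = λ p → Q.from (P.from p)
    ; from-to   = λ p → trans (cong Q.from (P.from-to (Q.to p))) (Q.from-to p)
    ; to-from   = λ p → trans (cong P.to (Q.to-from (P.from p))) (P.to-from p)
    ; to-mirror = λ p → trans (cong P.to (Q.to-mirror p)) (P.to-mirror (Q.to p))
    }
    where
    module P = SignedPermutation P
    module Q = SignedPermutation Q

  flipCount : SignedPermutation → ℕ
  flipCount Φ = ∑.sum λ a → 𝟙 (isLower? (SignedPermutation.to Φ (upper a)))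

  relabel : (Fin n → Fin n) → Pos n → Pos n
  relabel f (upper a) = upper (f a)
  relabel f (lower a) = lower (f a)
  relabel f middle    = middle

  permuting : Permutation′ n → SignedPermutation
  permuting σ = record
    { to        = relabel (σ ⟨$⟩ʳ_)
    ; from      = relabel (σ ⟨$⟩ˡ_)
    ; from-to   = λ { (upper a) → cong upper (Perm.inverseˡ σ)
                    ; (lower a) → cong lower (Perm.inverseˡ σ)
                    ; middle    → refl }
    ; to-from   = λ { (upper a) → cong upper (Perm.inverseʳ σ)
                    ; (lower a) → cong lower (Perm.inverseʳ σ)
                    ; middle    → refl }
    ; to-mirror = λ { (upper a) → refl ; (lower a) → refl ; middle → refl }
    }

  signAt : (Fin n → Sign) → Pos n → Sign
  signAt ε (upper a) = ε a
  signAt ε (lower a) = ε a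
  signAt ε middle    = Sign.+

  signAt-mirror : ∀ ε p → signAt ε (mirror p) ≡ signAt ε p
  signAt-mirror ε (upper a) = refl
  signAt-mirror ε (lower a) = refl
  signAt-mirror ε middle    = refl

  mirrorIf : Sign → Pos n → Pos n
  mirrorIf Sign.+ p = p
  mirrorIf Sign.- p = mirror p

  mirrorIf-mirror : ∀ s p → mirrorIf s (mirror p) ≡ mirror (mirrorIf s p)
  mirrorIf-mirror Sign.+ p = refl
  mirrorIf-mirror Sign.- p = refl

  signAt-mirrorIf : ∀ ε s p → signAt ε (mirrorIf s p) ≡ signAt ε p
  signAt-mirrorIf ε Sign.+ p = refl
  signAt-mirrorIf ε Sign.- p = signAt-mirror ε p

  mirrorIf-* : ∀ s t p → mirrorIf s (mirrorIf t p) ≡ mirrorIf (s Sign.* t) p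
  mirrorIf-* Sign.+ t      p = refl
  mirrorIf-* Sign.- Sign.+ p = refl
  mirrorIf-* Sign.- Sign.- p = mirror-involutive p

  flip : (Fin n → Sign) → Pos n → Pos n
  flip ε p = mirrorIf (signAt ε p) p

  flip-involutive : ∀ ε p → flip ε (flip ε p) ≡ p
  flip-involutive ε p = begin
    mirrorIf (signAt ε (flip ε p)) (flip ε p)
      ≡⟨ cong (λ s → mirrorIf s (flip ε p)) (signAt-mirrorIf ε (signAt ε p) p) ⟩
    mirrorIf (signAt ε p) (mirrorIf (signAt ε p) p)
      ≡⟨ mirrorIf-* (signAt ε p) _ p ⟩
    mirrorIf (signAt ε p Sign.* signAt ε p) p
      ≡⟨ cong (λ s → mirrorIf s p) (s*s≡+ (signAt ε p)) ⟩
    p ∎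
    where
    open ≡-Reasoning
    s*s≡+ : ∀ s → s Sign.* s ≡ Sign.+
    s*s≡+ Sign.+ = refl
    s*s≡+ Sign.- = refl

  flip-mirror : ∀ ε p → flip ε (mirror p) ≡ mirror (flip ε p)
  flip-mirror ε p = trans (cong (λ s → mirrorIf s (mirror p)) (signAt-mirror ε p)) (mirrorIf-mirror (signAt ε p) p)

  flipping : (Fin n → Sign) → SignedPermutation
  flipping ε = record
    { to = flip ε ; from = flip ε
    ; from-to = flip-involutive ε ; to-from = flip-involutive ε
    ; to-mirror = flip-mirror ε
    }

  signed : (Fin n → Sign) → Permutation′ n → SignedPermutation
  signed ε σ = flipping ε ∘ₛ permuting σ

  relabel-mirrorIf : ∀ f s p → relabel f (mirrorIf s p) ≡ mirrorIf s (relabel f p)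
  relabel-mirrorIf f Sign.+ p         = refl
  relabel-mirrorIf f Sign.- (upper a) = refl
  relabel-mirrorIf f Sign.- (lower a) = refl
  relabel-mirrorIf f Sign.- middle    = refl

  signAt-relabel : ∀ ε (σ : Permutation′ n) p → signAt (λ i → ε (σ ⟨$⟩ˡ i)) (relabel (σ ⟨$⟩ʳ_) p) ≡ signAt ε p
  signAt-relabel ε σ (upper a) = cong ε (Perm.inverseˡ σ)
  signAt-relabel ε σ (lower a) = cong ε (Perm.inverseˡ σ)
  signAt-relabel ε σ middle    = refl

  signAt-* : ∀ ε ε′ p → signAt (λ i → ε i Sign.* ε′ i) p ≡ signAt ε p Sign.* signAt ε′ p
  signAt-* ε ε′ (upper a) = refl
  signAt-* ε ε′ (lower a) = refl
  signAt-* ε ε′ middle    = refl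

  flip-flip : ∀ ε ε′ p → flip ε (flip ε′ p) ≡ flip (λ i → ε i Sign.* ε′ i) p
  flip-flip ε ε′ p = begin
    mirrorIf (signAt ε (flip ε′ p)) (flip ε′ p)
      ≡⟨ cong (λ s → mirrorIf s (flip ε′ p)) (signAt-mirrorIf ε (signAt ε′ p) p) ⟩
    mirrorIf (signAt ε p) (mirrorIf (signAt ε′ p) p)
      ≡⟨ mirrorIf-* (signAt ε p) (signAt ε′ p) p ⟩
    mirrorIf (signAt ε p Sign.* signAt ε′ p) p
      ≡⟨ cong (λ s → mirrorIf s p) (signAt-* ε ε′ p) ⟨
    flip (λ i → ε i Sign.* ε′ i) p ∎
    where open ≡-Reasoning

  relabel-flip : ∀ ε (σ : Permutation′ n) p →
                 relabel (σ ⟨$⟩ʳ_) (flip ε p) ≡ flip (λ i → ε (σ ⟨$⟩ˡ i)) (relabel (σ ⟨$⟩ʳ_) p)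
  relabel-flip ε σ p = trans (relabel-mirrorIf (σ ⟨$⟩ʳ_) (signAt ε p) p)
    (cong (λ s → mirrorIf s (relabel (σ ⟨$⟩ʳ_) p)) (sym (signAt-relabel ε σ p)))

  relabel-relabel : ∀ f g p → relabel f (relabel g p) ≡ relabel (λ a → f (g a)) p
  relabel-relabel f g (upper a) = refl
  relabel-relabel f g (lower a) = refl
  relabel-relabel f g middle    = refl

  signed-compose : ∀ ε σ ε′ σ′ p →
    to (signed (λ i → ε i Sign.* ε′ (σ ⟨$⟩ˡ i)) (σ′ Perm.∘ₚ σ)) p ≡ to (signed ε σ) (to (signed ε′ σ′) p)
  signed-compose ε σ ε′ σ′ p = begin
    flip (λ i → ε i Sign.* ε′ (σ ⟨$⟩ˡ i)) (relabel (λ a → σ ⟨$⟩ʳ (σ′ ⟨$⟩ʳ a)) p)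
      ≡⟨ cong (flip _) (relabel-relabel (σ ⟨$⟩ʳ_) (σ′ ⟨$⟩ʳ_) p) ⟨
    flip (λ i → ε i Sign.* ε′ (σ ⟨$⟩ˡ i)) (relabel (σ ⟨$⟩ʳ_) q)
      ≡⟨ flip-flip ε (λ i → ε′ (σ ⟨$⟩ˡ i)) (relabel (σ ⟨$⟩ʳ_) q) ⟨
    flip ε (flip (λ i → ε′ (σ ⟨$⟩ˡ i)) (relabel (σ ⟨$⟩ʳ_) q))
      ≡⟨ cong (flip ε) (relabel-flip ε′ σ q) ⟨
    flip ε (relabel (σ ⟨$⟩ʳ_) (flip ε′ q)) ∎
    where
    open ≡-Reasoning
    q : Pos n
    q = relabel (σ′ ⟨$⟩ʳ_) p

  lower-mirrorIf-upper : ∀ s a → IsLower (mirrorIf s (upper a)) → s ≡ Sign.-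
  lower-mirrorIf-upper Sign.- a _ = refl

  mirrorIf-upper-lower : ∀ s a → s ≡ Sign.- → IsLower (mirrorIf s (upper a))
  mirrorIf-upper-lower Sign.- a _ = _

  flipCount-signed : ∀ ε σ → flipCount (signed ε σ) ≡ countMinus ε
  flipCount-signed ε σ = begin
    ∑.sum (λ a → 𝟙 (isLower? (mirrorIf (ε (σ ⟨$⟩ʳ a)) (upper (σ ⟨$⟩ʳ a)))))
      ≡⟨ ∑.sum-cong-≗ (λ a → 𝟙-cong (isLower? _) (ε (σ ⟨$⟩ʳ a) ≟ Sign.-)
           (lower-mirrorIf-upper _ _) (mirrorIf-upper-lower _ _)) ⟩
    ∑.sum (λ a → 𝟙 (ε (σ ⟨$⟩ʳ a) ≟ Sign.-))
      ≡⟨ ∑.sum-permute (λ i → 𝟙 (ε i ≟ Sign.-)) σ ⟨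
    ∑.sum (λ i → 𝟙 (ε i ≟ Sign.-))
      ≡⟨ countMinus≡∑ ε ⟨
    countMinus ε ∎
    where open ≡-Reasoning

module Positions (m : ℕ) (0<m : 0 ℕ.< m) where
  open import Data.Nat.Base using (suc; _+_; _∸_; _/_; _%_; _≤_; _<_; >-nonZero)
  open import Data.Nat.Properties
  open import Data.Nat.DivMod using (m%n<n; m/n<m)
  open import Data.Fin.Base as Fin using (Fin; toℕ; opposite; fromℕ<; inject≤)
  open import Data.Fin.Properties using (toℕ-inject≤; toℕ-fromℕ<; toℕ-injective; opposite-prop; opposite-involutive; toℕ<n)
  open import Data.Fin.Permutation as Perm using (Permutation′)
  import Algebra.Properties.CommutativeMonoid.Sum +-0-commutativeMonoid as ∑
  open FiniteSums +-0-commutativeMonoid using (sum-inject≤)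
  open Inversions using (𝟙; 𝟙-cong; 𝟙-no; Inverted; inverted?; crossings)
  open import Data.Product using (_×_; _,_; proj₁; proj₂)
  open import Data.Empty using (⊥-elim)
  open import Relation.Nullary using (¬_; yes; no; _×-dec_)
  open import Relation.Binary.PropositionalEquality
  open import Function using (_∘_)

  n : ℕ
  n = m / 2

  m≡r+2n : m ≡ m % 2 + (n + n)
  m≡r+2n = Parity.halves m

  2n≤m : n + n ≤ m
  2n≤m = subst (n + n ≤_) (sym m≡r+2n) (m≤n+m (n + n) (m % 2))

  m≤1+2n : m ≤ suc (n + n)
  m≤1+2n = subst (_≤ suc (n + n)) (sym m≡r+2n) (+-monoˡ-≤ (n + n) (≤-pred (m%n<n m 2)))

  n<m : n < m
  n<m = m/n<m m 2 {{>-nonZero 0<m}} (n<1+n 1)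

  upperIdx lowerIdx : Fin n → Fin m
  upperIdx a = inject≤ a (<⇒≤ n<m)
  lowerIdx a = opposite (upperIdx a)

  middleIdx : Fin m
  middleIdx = fromℕ< n<m

  -- For even m no index is in the middle, and index middle is a junk value.
  index : Pos n → Fin m
  index (upper a) = upperIdx a
  index (lower a) = lowerIdx a
  index middle    = middleIdx

  toℕ-upperIdx : ∀ a → toℕ (upperIdx a) ≡ toℕ a
  toℕ-upperIdx a = toℕ-inject≤ a (<⇒≤ n<m)

  toℕ-lowerIdx : ∀ a → toℕ (lowerIdx a) ≡ m ∸ suc (toℕ a)
  toℕ-lowerIdx a = trans (opposite-prop (upperIdx a)) (cong (λ x → m ∸ suc x) (toℕ-upperIdx a))

  n≤m∸1+a : ∀ {a} → a < n → n ≤ m ∸ suc a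
  n≤m∸1+a {a} a<n = ≤-trans (m≤m+n n (n ∸ suc a))
    (≤-trans (≤-reflexive (sym (+-∸-assoc n a<n))) (∸-monoˡ-≤ (suc a) 2n≤m))

  m∸1+[m∸1+a]≡a : ∀ {a} → a < m → m ∸ suc (m ∸ suc a) ≡ a
  m∸1+[m∸1+a]≡a {a} a<m = trans (cong (m ∸_) (sym (+-∸-assoc 1 a<m))) (m∸[m∸n]≡n (<⇒≤ a<m))

  neither-half⇒middle : ∀ {i} → i < m → ¬ i < n → ¬ m ∸ suc i < n → i ≡ n × m ≡ suc (n + n)
  neither-half⇒middle {i} i<m i≮n m∸1+i≮n = i≡n , m≡1+2n
    where
    n+1+i≤m : n + suc i ≤ m
    n+1+i≤m = subst (n + suc i ≤_) (m∸n+n≡m i<m) (+-monoˡ-≤ (suc i) (≮⇒≥ m∸1+i≮n))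
    i≡n : i ≡ n
    i≡n = ≤-antisym
      (≤-pred (+-cancelˡ-≤ n (suc i) (suc n) (≤-trans n+1+i≤m (subst (m ≤_) (sym (+-suc n n)) m≤1+2n))))
      (≮⇒≥ i≮n)
    m≡1+2n : m ≡ suc (n + n)
    m≡1+2n = ≤-antisym m≤1+2n (subst (_≤ m) (+-suc n n) (subst (λ x → n + suc x ≤ m) i≡n n+1+i≤m))

  m∸1+lowerIdx : ∀ a → m ∸ suc (toℕ (lowerIdx a)) ≡ toℕ a
  m∸1+lowerIdx a = trans (cong (λ x → m ∸ suc x) (toℕ-lowerIdx a)) (m∸1+[m∸1+a]≡a (<-≤-trans (toℕ<n a) (<⇒≤ n<m)))

  pos-upperIdx : ∀ a → pos m (upperIdx a) ≡ upper a
  pos-upperIdx a with toℕ (upperIdx a) <? m / 2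
  ... | yes p = cong upper (toℕ-injective (trans (toℕ-fromℕ< p) (toℕ-upperIdx a)))
  ... | no ¬p = ⊥-elim (¬p (subst (_< n) (sym (toℕ-upperIdx a)) (toℕ<n a)))

  pos-lowerIdx : ∀ a → pos m (lowerIdx a) ≡ lower a
  pos-lowerIdx a with toℕ (lowerIdx a) <? m / 2
  ... | yes p = ⊥-elim (<⇒≱ p (subst (n ≤_) (sym (toℕ-lowerIdx a)) (n≤m∸1+a (toℕ<n a))))
  ... | no _ with m ∸ suc (toℕ (lowerIdx a)) <? m / 2
  ...   | yes q = cong lower (toℕ-injective (trans (toℕ-fromℕ< q) (m∸1+lowerIdx a)))
  ...   | no ¬q = ⊥-elim (¬q (subst (_< n) (sym (m∸1+lowerIdx a)) (toℕ<n a)))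

  pos≡middle : ∀ i → pos m i ≡ middle → toℕ i ≡ n × m ≡ suc (n + n)
  pos≡middle i e with toℕ i <? m / 2
  pos≡middle i () | yes _
  ... | no i≮n with m ∸ suc (toℕ i) <? m / 2
  pos≡middle i () | no _ | yes _
  ...   | no m∸1+i≮n = neither-half⇒middle (toℕ<n i) i≮n m∸1+i≮n

  open SignedPermutations n

  index-pos : ∀ i → index (pos m i) ≡ i
  index-pos i with toℕ i <? m / 2
  ... | yes p = toℕ-injective (trans (toℕ-upperIdx _) (toℕ-fromℕ< p))
  ... | no i≮n with m ∸ suc (toℕ i) <? m / 2
  ...   | yes q = toℕ-injective (trans (toℕ-lowerIdx _)
                    (trans (cong (λ x → m ∸ suc x) (toℕ-fromℕ< q)) (m∸1+[m∸1+a]≡a (toℕ<n i))))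
  ...   | no m∸1+i≮n = toℕ-injective (trans (toℕ-fromℕ< n<m)
                         (sym (proj₁ (neither-half⇒middle (toℕ<n i) i≮n m∸1+i≮n))))

  index-pos≡ : ∀ {i p} → pos m i ≡ p → index p ≡ i
  index-pos≡ {i} refl = index-pos i

  pos-injective : ∀ {i j} → pos m i ≡ pos m j → i ≡ j
  pos-injective {i} {j} e = trans (sym (index-pos i)) (index-pos≡ (sym e))

  m∸1+middleIdx : m ≡ suc (n + n) → m ∸ suc (toℕ middleIdx) ≡ n
  m∸1+middleIdx m≡1+2n = trans (cong₂ (λ a b → a ∸ suc b) m≡1+2n (toℕ-fromℕ< n<m)) (m+n∸m≡n n n)

  pos-middleIdx : m ≡ suc (n + n) → pos m middleIdx ≡ middle
  pos-middleIdx m≡1+2n with toℕ middleIdx <? m / 2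
  ... | yes p = ⊥-elim (<-irrefl (toℕ-fromℕ< n<m) p)
  ... | no _ with m ∸ suc (toℕ middleIdx) <? m / 2
  ...   | yes q = ⊥-elim (<-irrefl (m∸1+middleIdx m≡1+2n) q)
  ...   | no _  = refl

  pos≢middle : m ≡ n + n → ∀ i → pos m i ≢ middle
  pos≢middle m≡2n i e = 1+n≢n (trans (sym (proj₂ (pos≡middle i e))) m≡2n)

  pos-index : ∀ p → (p ≡ middle → m ≡ suc (n + n)) → pos m (index p) ≡ p
  pos-index (upper a) _   = pos-upperIdx a
  pos-index (lower a) _   = pos-lowerIdx a
  pos-index middle    odd = pos-middleIdx (odd refl)

  opposite-middle : ∀ {i} → pos m i ≡ middle → opposite i ≡ i
  opposite-middle {i} e = toℕ-injective (begin
    toℕ (opposite i)   ≡⟨ opposite-prop i ⟩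
    m ∸ suc (toℕ i)    ≡⟨ cong₂ (λ a b → a ∸ suc b) m≡1+2n i≡n ⟩
    suc (n + n) ∸ suc n ≡⟨ m+n∸m≡n n n ⟩
    n                  ≡⟨ i≡n ⟨
    toℕ i              ∎)
    where
    open ≡-Reasoning
    i≡n : toℕ i ≡ n
    i≡n = proj₁ (pos≡middle i e)
    m≡1+2n : m ≡ suc (n + n)
    m≡1+2n = proj₂ (pos≡middle i e)

  pos-opposite : ∀ i → pos m (opposite i) ≡ mirror (pos m i)
  pos-opposite i with pos m i in e
  ... | upper a = trans (cong (pos m ∘ opposite) (sym (index-pos≡ e))) (pos-lowerIdx a)
  ... | lower a = trans (cong (pos m ∘ opposite) (sym (index-pos≡ e)))
                    (trans (cong (pos m) (opposite-involutive (upperIdx a))) (pos-upperIdx a))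
  ... | middle  = trans (cong (pos m) (opposite-middle e)) e

  upper⇒<opposite : ∀ i → IsUpper (pos m i) → i Fin.< opposite i
  upper⇒<opposite i up with pos m i in e
  ... | upper a = subst (λ x → x Fin.< opposite x) (index-pos≡ e)
    (subst₂ _<_ (sym (toℕ-upperIdx a)) (sym (toℕ-lowerIdx a)) (<-≤-trans (toℕ<n a) (n≤m∸1+a (toℕ<n a))))

  <opposite⇒upper : ∀ i → i Fin.< opposite i → IsUpper (pos m i)
  <opposite⇒upper i i<i′ with pos m i in e
  ... | upper a = _
  ... | lower a = <-asym i<i′ (subst (λ x → opposite x Fin.< x) (index-pos≡ e)
    (subst₂ _<_ (sym (trans (cong toℕ (opposite-involutive (upperIdx a))) (toℕ-upperIdx a))) (sym (toℕ-lowerIdx a))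
      (<-≤-trans (toℕ<n a) (n≤m∸1+a (toℕ<n a)))))
  ... | middle  = <-irrefl (sym (cong toℕ (opposite-middle e))) i<i′

  module Lift (Φ : SignedPermutation) where
    open SignedPermutation Φ

    lift unlift : Fin m → Fin m
    lift   j = index (to (pos m j))
    unlift j = index (from (pos m j))

    pos-lift : ∀ j → pos m (lift j) ≡ to (pos m j)
    pos-lift j = pos-index (to (pos m j)) (λ e → proj₂ (pos≡middle j (to≡middle e)))

    pos-unlift : ∀ j → pos m (unlift j) ≡ from (pos m j)
    pos-unlift j = pos-index (from (pos m j)) (λ e → proj₂ (pos≡middle j (from≡middle e)))

    unlift-lift : ∀ j → unlift (lift j) ≡ j
    unlift-lift j = trans (cong (index ∘ from) (pos-lift j)) (trans (cong index (from-to _)) (index-pos j))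

    lift-unlift : ∀ j → lift (unlift j) ≡ j
    lift-unlift j = trans (cong (index ∘ to) (pos-unlift j)) (trans (cong index (to-from _)) (index-pos j))

    lift-opposite : ∀ j → lift (opposite j) ≡ opposite (lift j)
    lift-opposite j = pos-injective (begin
      pos m (lift (opposite j))   ≡⟨ pos-lift (opposite j) ⟩
      to (pos m (opposite j))     ≡⟨ cong to (pos-opposite j) ⟩
      to (mirror (pos m j))       ≡⟨ to-mirror (pos m j) ⟩
      mirror (to (pos m j))       ≡⟨ cong mirror (pos-lift j) ⟨
      mirror (pos m (lift j))     ≡⟨ pos-opposite (lift j) ⟨
      pos m (opposite (lift j))   ∎)
      where open ≡-Reasoning

    permutation : Permutation′ m
    permutation = Perm.permutation lift unlift lift-unlift unlift-lift

  lift-∘ₛ : ∀ Φ Ψ j → Lift.lift (Φ ∘ₛ Ψ) j ≡ Lift.lift Φ (Lift.lift Ψ j)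
  lift-∘ₛ Φ Ψ j = cong (index ∘ SignedPermutation.to Φ) (sym (Lift.pos-lift Ψ j))

  opposite<⇒lower : ∀ i → opposite i Fin.< i → IsLower (pos m i)
  opposite<⇒lower i i′<i = subst IsUpper (pos-opposite i)
    (<opposite⇒upper (opposite i) (subst (opposite i Fin.<_) (sym (opposite-involutive i)) i′<i))

  lower⇒opposite< : ∀ i → IsLower (pos m i) → opposite i Fin.< i
  lower⇒opposite< i low = subst (opposite i Fin.<_) (opposite-involutive i)
    (upper⇒<opposite (opposite i) (subst IsUpper (sym (pos-opposite i)) low))

  sum-over-upper : (h : Pos n → ℕ) → (∀ p → ¬ IsUpper p → h p ≡ 0) →
                   ∑.sum (λ i → h (pos m i)) ≡ ∑.sum (λ a → h (upper a))
  sum-over-upper h h≡0 = trans (sum-inject≤ (<⇒≤ n<m) (h ∘ pos m) beyond) (∑.sum-cong-≗ (cong h ∘ pos-upperIdx))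
    where
    beyond : ∀ i → n ≤ toℕ i → h (pos m i) ≡ 0
    beyond i n≤i with pos m i in e
    ... | upper a = ⊥-elim (<⇒≱ (subst (_< n) (trans (sym (toℕ-upperIdx a)) (cong toℕ (index-pos≡ e))) (toℕ<n a)) n≤i)
    ... | lower a = h≡0 (lower a) λ ()
    ... | middle  = h≡0 middle λ ()

  crossings-lift : ∀ Φ → crossings (Lift.lift Φ) ≡ flipCount Φ
  crossings-lift Φ = begin
    ∑.sum (λ i → 𝟙 (inverted? lift i (opposite i)))
      ≡⟨ ∑.sum-cong-≗ (λ i → 𝟙-cong (inverted? lift i (opposite i)) _
                                    (crossing⇒upper→lower i) (upper→lower⇒crossing i)) ⟩
    ∑.sum (λ i → h (pos m i))
      ≡⟨ sum-over-upper h (λ p ¬up → 𝟙-no (isUpper? p ×-dec _) (¬up ∘ proj₁)) ⟩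
    ∑.sum (λ a → h (upper a))
      ≡⟨ ∑.sum-cong-≗ (λ a → 𝟙-cong (isUpper? (upper a) ×-dec isLower? (to (upper a))) (isLower? _) proj₂ (_ ,_)) ⟩
    flipCount Φ ∎
    where
    open ≡-Reasoning
    open Lift Φ
    open SignedPermutation Φ using (to)
    h : Pos n → ℕ
    h p = 𝟙 (isUpper? p ×-dec isLower? (to p))
    crossing⇒upper→lower : ∀ i → Inverted lift i (opposite i) → IsUpper (pos m i) × IsLower (to (pos m i))
    crossing⇒upper→lower i (i<i′ , li′<li) = <opposite⇒upper i i<i′ ,
      subst IsLower (pos-lift i) (opposite<⇒lower (lift i) (subst (Fin._< lift i) (lift-opposite i) li′<li))
    upper→lower⇒crossing : ∀ i → IsUpper (pos m i) × IsLower (to (pos m i)) → Inverted lift i (opposite i)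
    upper→lower⇒crossing i (up , low) = upper⇒<opposite i up ,
      subst (Fin._< lift i) (sym (lift-opposite i)) (lower⇒opposite< (lift i) (subst IsLower (sym (pos-lift i)) low))

module WeylSection {c ℓ} (R : CommutativeRing c ℓ) (m : ℕ) (0<m : 0 ℕ.< m) where
  open CommutativeRing R hiding (zero)
  open SO R m
  open Signs R m
  open MonomialMatrices R m
  open SignedPermutations n
  open Positions m 0<m hiding (n)
  open Inversions using (inversions; crossings; inversions≡double+crossings)
  open import Algebra.Properties.CommutativeMonoid.Sum *-commutativeMonoid using () renaming (sum to ∏)
  module Products = FiniteSums *-commutativeMonoid
  open import Data.Sum using (inj₁; inj₂)
  open import Data.Fin.Base using (Fin; opposite)
  import Data.Fin.Properties as Fin
  open import Data.Fin.Permutation as Perm using (_⟨$⟩ʳ_; _⟨$⟩ˡ_)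
  open import Data.Sign.Base as Sign using (Sign)
  open import Data.Product using (_×_; _,_; proj₁)
  open import Relation.Nullary using (Dec; yes; no)
  open import Relation.Binary.PropositionalEquality as ≡ using (_≡_; _≢_)
  open import Function using (_∘_; case_of_)
  open import Data.Empty using (⊥-elim)
  open SignedPermutation using (to)

  signedPerm : W → SignedPermutation
  signedPerm (ε , σ) = signed ε σ

  ρ : W → Fin m → Fin m
  ρ w = Lift.lift (signedPerm w)

  coefficient : (Fin n → Sign) → Pos n → Carrier
  coefficient ε (upper _) = 1#
  coefficient ε (lower _) = 1#
  coefficient ε middle    = neg1^ (countMinus ε)

  coefficients : W → Fin m → Carrier
  coefficients (ε , _) j = coefficient ε (pos m j)

  δ-lift : ∀ Φ i j → δ (i Fin.≟ Lift.lift Φ j) ≈ δ (pos m i ≟ₚ to Φ (pos m j))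
  δ-lift Φ i j = δ-cong (i Fin.≟ Lift.lift Φ j) (pos m i ≟ₚ to Φ (pos m j))
    (λ e → ≡.trans (≡.cong (pos m) e) (Lift.pos-lift Φ j))
    (λ e → pos-injective (≡.trans e (≡.sym (Lift.pos-lift Φ j))))

  sS-entry : ∀ σ i j → sS σ i j ≈ δ (pos m i ≟ₚ to (permuting σ) (pos m j))
  sS-entry σ i j with pos m i | pos m j
  ... | upper a | upper b = δ-cong (a Fin.≟ σ ⟨$⟩ʳ b) (upper a ≟ₚ upper (σ ⟨$⟩ʳ b)) (≡.cong upper) upper-injective
  ... | lower a | lower b = δ-cong (a Fin.≟ σ ⟨$⟩ʳ b) (lower a ≟ₚ lower (σ ⟨$⟩ʳ b)) (≡.cong lower) lower-injective
  ... | middle  | middle  = refl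
  ... | upper _ | lower _ = refl
  ... | upper _ | middle  = refl
  ... | lower _ | upper _ = refl
  ... | lower _ | middle  = refl
  ... | middle  | upper _ = refl
  ... | middle  | lower _ = refl

  sS-monomial : ∀ σ → sS σ ≈M monomial (Lift.lift (permuting σ)) (λ _ → 1#)
  sS-monomial σ i j = trans (sS-entry σ i j) (trans (sym (δ-lift (permuting σ) i j)) (sym (*-identityʳ _)))

  swapε≡lift : ∀ ε j → swapε ε j ≡ Lift.lift (flipping ε) j
  swapε≡lift ε j with pos m j in e
  ... | upper a with ε a
  ...   | Sign.+ = ≡.sym (index-pos≡ e)
  ...   | Sign.- = ≡.cong opposite (≡.sym (index-pos≡ e))
  swapε≡lift ε j | lower a with ε a
  ...   | Sign.+ = ≡.sym (index-pos≡ e)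
  ...   | Sign.- = ≡.trans (≡.cong opposite (≡.sym (index-pos≡ e))) (Fin.opposite-involutive (upperIdx a))
  swapε≡lift ε j | middle = ≡.sym (index-pos≡ e)

  swappedI-entry : ∀ ε i j → swappedI ε i j ≈ δ (pos m i ≟ₚ flip ε (pos m j))
  swappedI-entry ε i j = trans
    (δ-cong (i Fin.≟ swapε ε j) (i Fin.≟ Lift.lift (flipping ε) j)
      (λ e → ≡.trans e (swapε≡lift ε j)) (λ e → ≡.trans e (≡.sym (swapε≡lift ε j))))
    (δ-lift (flipping ε) i j)

  swappedI-at : ∀ ε {i j p q} → pos m i ≡ p → pos m j ≡ q → swappedI ε i j ≈ δ (p ≟ₚ flip ε q)
  swappedI-at ε {i} {j} ei ej = trans (swappedI-entry ε i j) (reflexive (≡.cong₂ (λ p q → δ (p ≟ₚ flip ε q)) ei ej))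

  dε-entry : ∀ ε i j → dε ε i j ≈ δ (pos m i ≟ₚ flip ε (pos m j)) * coefficient ε (pos m j)
  dε-entry ε i j with pos m i in ei | pos m j in ej
  ... | middle  | middle  = sym (*-identityˡ _)
  ... | upper _ | middle  = trans (swappedI-at ε ei ej) (sym (zeroˡ _))
  ... | lower _ | middle  = trans (swappedI-at ε ei ej) (sym (zeroˡ _))
  ... | upper _ | upper _ = trans (swappedI-at ε ei ej) (sym (*-identityʳ _))
  ... | upper _ | lower _ = trans (swappedI-at ε ei ej) (sym (*-identityʳ _))
  ... | lower _ | upper _ = trans (swappedI-at ε ei ej) (sym (*-identityʳ _))
  ... | lower _ | lower _ = trans (swappedI-at ε ei ej) (sym (*-identityʳ _))
  ... | middle  | upper _ = trans (swappedI-at ε ei ej) (sym (*-identityʳ _))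
  ... | middle  | lower _ = trans (swappedI-at ε ei ej) (sym (*-identityʳ _))

  dε-monomial : ∀ ε → dε ε ≈M monomial (Lift.lift (flipping ε)) (λ j → coefficient ε (pos m j))
  dε-monomial ε i j = trans (dε-entry ε i j) (*-congʳ (sym (δ-lift (flipping ε) i j)))

  coefficient-off-middle : ∀ ε {p} → p ≢ middle → coefficient ε p ≡ 1#
  coefficient-off-middle ε {upper _} _ = ≡.refl
  coefficient-off-middle ε {lower _} _ = ≡.refl
  coefficient-off-middle ε {middle} p≢middle = ⊥-elim (p≢middle ≡.refl)

  coefficient-to : ∀ ε Φ p → coefficient ε (to Φ p) ≡ coefficient ε p
  coefficient-to ε Φ (upper a) = coefficient-off-middle ε λ e → case SignedPermutation.to≡middle Φ e of λ ()
  coefficient-to ε Φ (lower a) = coefficient-off-middle ε λ e → case SignedPermutation.to≡middle Φ e of λ ()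
  coefficient-to ε Φ middle    = ≡.cong (coefficient ε) (SignedPermutation.to-middle Φ)

  coefficient-mirror : ∀ ε p → coefficient ε (mirror p) ≡ coefficient ε p
  coefficient-mirror ε (upper a) = ≡.refl
  coefficient-mirror ε (lower a) = ≡.refl
  coefficient-mirror ε middle    = ≡.refl

  coefficient-square : ∀ ε p → coefficient ε p * coefficient ε p ≈ 1#
  coefficient-square ε (upper a) = *-identityˡ 1#
  coefficient-square ε (lower a) = *-identityˡ 1#
  coefficient-square ε middle    = neg1^-square (countMinus ε)

  s-monomial : ∀ w → s w ≈M monomial (ρ w) (coefficients w)
  s-monomial (ε , σ) = begin
    dε ε ⊗ sS σ
      ≈⟨ ⊗-cong (dε-monomial ε) (sS-monomial σ) ⟩
    monomial (Lift.lift (flipping ε)) (λ j → coefficient ε (pos m j)) ⊗ monomial (Lift.lift (permuting σ)) (λ _ → 1#)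
      ≈⟨ monomial-⊗ _ _ _ _ ⟩
    monomial (λ j → Lift.lift (flipping ε) (Lift.lift (permuting σ) j))
             (λ j → coefficient ε (pos m (Lift.lift (permuting σ) j)) * 1#)
      ≈⟨ monomial-cong (λ j → ≡.sym (lift-∘ₛ (flipping ε) (permuting σ) j)) coefficient-relabelled ⟩
    monomial (ρ (ε , σ)) (coefficients (ε , σ)) ∎
    where
    open ≈M-Reasoning m
    coefficient-relabelled : ∀ j → coefficient ε (pos m (Lift.lift (permuting σ) j)) * 1# ≈ coefficient ε (pos m j)
    coefficient-relabelled j = trans (*-identityʳ _) (reflexive (≡.trans
      (≡.cong (coefficient ε) (Lift.pos-lift (permuting σ) j)) (coefficient-to ε (permuting σ) (pos m j))))

  coefficient-opposite-square : ∀ ε x → coefficient ε (pos m (opposite x)) * 1# * coefficient ε (pos m x) ≈ 1#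
  coefficient-opposite-square ε x = begin
    coefficient ε (pos m (opposite x)) * 1# * cₓ  ≈⟨ *-congʳ (*-identityʳ _) ⟩
    coefficient ε (pos m (opposite x)) * cₓ       ≡⟨ ≡.cong (λ p → coefficient ε p * cₓ) (pos-opposite x) ⟩
    coefficient ε (mirror (pos m x)) * cₓ         ≡⟨ ≡.cong (_* cₓ) (coefficient-mirror ε (pos m x)) ⟩
    cₓ * cₓ                                       ≈⟨ coefficient-square ε (pos m x) ⟩
    1#                                            ∎
    where
    open ≈-Reasoning
    cₓ : Carrier
    cₓ = coefficient ε (pos m x)

  J-monomial : J ≈M monomial opposite (λ _ → 1#)
  J-monomial i j = sym (*-identityʳ _)

  s-orthogonal : ∀ w → s w ⊗ J ⊗ ᵗ (s w) ≈M J
  s-orthogonal w@(ε , _) = begin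
    s w ⊗ J ⊗ ᵗ (s w)
      ≈⟨ ⊗-cong (⊗-cong (s-monomial w) J-monomial) (ᵗ-cong (s-monomial w)) ⟩
    monomial lift cs ⊗ monomial opposite (λ _ → 1#) ⊗ ᵗ (monomial lift cs)
      ≈⟨ ⊗-cong (monomial-⊗ _ _ _ _) (ᵗ-monomial lift unlift cs unlift-lift lift-unlift) ⟩
    monomial (lift ∘ opposite) (λ j → cs (opposite j) * 1#) ⊗ monomial unlift (cs ∘ unlift)
      ≈⟨ monomial-⊗ _ _ _ _ ⟩
    monomial (λ j → lift (opposite (unlift j))) (λ j → cs (opposite (unlift j)) * 1# * cs (unlift j))
      ≈⟨ monomial-cong (λ j → ≡.trans (lift-opposite (unlift j)) (≡.cong opposite (lift-unlift j)))
                       (λ j → coefficient-opposite-square ε (unlift j)) ⟩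
    monomial opposite (λ _ → 1#)
      ≈⟨ J-monomial ⟨
    J ∎
    where
    open ≈M-Reasoning m
    open Lift (signedPerm w)
    cs : Fin m → Carrier
    cs = coefficients w

  ∏-coefficients-even : m ≡ n ℕ.+ n → ∀ ε → ∏ (λ j → coefficient ε (pos m j)) ≈ 1#
  ∏-coefficients-even m≡2n ε = Products.sum-zeros (λ j → reflexive (coefficient-off-middle ε (pos≢middle m≡2n j)))

  ∏-coefficients-odd : m ≡ ℕ.suc (n ℕ.+ n) → ∀ ε → ∏ (λ j → coefficient ε (pos m j)) ≈ neg1^ (countMinus ε)
  ∏-coefficients-odd m≡1+2n ε = trans
    (Products.sum-single _ middleIdx (λ j j≢mid → reflexive (coefficient-off-middle ε λ e → j≢mid (≡.sym (index-pos≡ e)))))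
    (reflexive (≡.cong (coefficient ε) (pos-middleIdx m≡1+2n)))

  neg1^-inversions : ∀ w → neg1^ (inversions (ρ w)) ≈ neg1^ (countMinus (proj₁ w))
  neg1^-inversions w@(ε , σ) with inversions≡double+crossings (ρ w) (Lift.lift-opposite (signedPerm w))
  ... | y , inversions≡ = begin
    neg1^ (inversions (ρ w))                     ≡⟨ ≡.cong neg1^ inversions≡ ⟩
    neg1^ (y ℕ.+ y ℕ.+ crossings (ρ w))          ≈⟨ neg1^-+ (y ℕ.+ y) _ ⟩
    neg1^ (y ℕ.+ y) * neg1^ (crossings (ρ w))    ≈⟨ *-congʳ (neg1^-double y) ⟩
    1# * neg1^ (crossings (ρ w))                 ≈⟨ *-identityˡ _ ⟩
    neg1^ (crossings (ρ w))                      ≡⟨ ≡.cong neg1^ crossings≡countMinus ⟩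
    neg1^ (countMinus ε)                         ∎
    where
    open ≈-Reasoning
    crossings≡countMinus : crossings (ρ w) ≡ countMinus ε
    crossings≡countMinus = ≡.trans (crossings-lift (signed ε σ)) (flipCount-signed ε σ)

  det-s≈1 : ∀ w → InD (proj₁ w) → det m (s w) ≈ 1#
  det-s≈1 w@(ε , σ) w∈D = begin
    det m (s w)                                   ≈⟨ det-cong m (s-monomial w) ⟩
    det m (monomial (ρ w) (coefficients w))       ≈⟨ det-monomial m (Lift.permutation (signedPerm w)) (coefficients w) ⟩
    neg1^ (inversions (ρ w)) * ∏ (coefficients w) ≈⟨ *-congʳ (neg1^-inversions w) ⟩
    neg1^ (countMinus ε) * ∏ (coefficients w)     ≈⟨ cancel (Parity.even-or-odd m) ⟩
    1#                                            ∎
    where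
    open ≈-Reasoning
    cancel : _ → neg1^ (countMinus ε) * ∏ (coefficients w) ≈ 1#
    cancel (inj₁ (m%2≡0 , m≡2n)) =
      trans (*-cong (neg1^-even (countMinus ε) (w∈D m%2≡0)) (∏-coefficients-even m≡2n ε)) (*-identityˡ 1#)
    cancel (inj₂ m≡1+2n)         = trans (*-congˡ (∏-coefficients-odd m≡1+2n ε)) (neg1^-square (countMinus ε))

  entry : (Fin n → Carrier) × (Fin n → Carrier) → Pos n → Carrier
  entry (t , u) (upper a) = t a
  entry (t , u) (lower a) = u a
  entry (t , u) middle    = 1#

  diagT-row : ∀ x i j → diagT x i j ≈ δ (i Fin.≟ j) * entry x (pos m i)
  diagT-row x i j with pos m i
  ... | upper _ = refl
  ... | lower _ = refl
  ... | middle  = sym (*-identityʳ _)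

  diagT-monomial : ∀ x → diagT x ≈M monomial (λ j → j) (λ j → entry x (pos m j))
  diagT-monomial x i j = trans (diagT-row x i j) (same-column (i Fin.≟ j))
    where
    same-column : (d : Dec (i ≡ j)) → δ d * entry x (pos m i) ≈ δ d * entry x (pos m j)
    same-column (yes ≡.refl) = refl
    same-column (no _)       = trans (zeroˡ _) (sym (zeroˡ _))

  entry-actS : ∀ σ x p → entry (actS σ x) (relabel (σ ⟨$⟩ʳ_) p) ≡ entry x p
  entry-actS σ (t , u) (upper a) = ≡.cong t (Perm.inverseˡ σ)
  entry-actS σ (t , u) (lower a) = ≡.cong u (Perm.inverseˡ σ)
  entry-actS σ (t , u) middle    = ≡.refl

  entry-actD : ∀ ε x p → entry (actD ε x) (flip ε p) ≡ entry x p
  entry-actD ε x (upper a) with ε a in e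
  ... | Sign.+ rewrite e = ≡.refl
  ... | Sign.- rewrite e = ≡.refl
  entry-actD ε x (lower a) with ε a in e
  ... | Sign.+ rewrite e = ≡.refl
  ... | Sign.- rewrite e = ≡.refl
  entry-actD ε x middle = ≡.refl

  entry-actW : ∀ w x p → entry (actW w x) (to (signedPerm w) p) ≡ entry x p
  entry-actW (ε , σ) x p = ≡.trans (entry-actD ε (actS σ x) (relabel (σ ⟨$⟩ʳ_) p)) (entry-actS σ x p)

  s-normalises : ∀ w x → s w ⊗ diagT x ≈M diagT (actW w x) ⊗ s w
  s-normalises w x = begin
    s w ⊗ diagT x                                     ≈⟨ ⊗-cong (s-monomial w) (diagT-monomial x) ⟩
    monomial (ρ w) cs ⊗ monomial (λ j → j) d          ≈⟨ monomial-⊗ _ _ _ _ ⟩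
    monomial (ρ w) (λ j → cs j * d j)                 ≈⟨ monomial-cong (λ _ → ≡.refl) moved ⟩
    monomial (ρ w) (λ j → d′ (ρ w j) * cs j)          ≈⟨ monomial-⊗ _ _ _ _ ⟨
    monomial (λ j → j) d′ ⊗ monomial (ρ w) cs         ≈⟨ ⊗-cong (diagT-monomial (actW w x)) (s-monomial w) ⟨
    diagT (actW w x) ⊗ s w                            ∎
    where
    open ≈M-Reasoning m
    cs d d′ : Fin m → Carrier
    cs = coefficients w
    d j = entry x (pos m j)
    d′ j = entry (actW w x) (pos m j)
    moved : ∀ j → cs j * d j ≈ d′ (ρ w j) * cs j
    moved j = trans (*-comm _ _) (*-congʳ (reflexive (≡.sym
      (≡.trans (≡.cong (entry (actW w x)) (Lift.pos-lift (signedPerm w) j)) (entry-actW w x (pos m j))))))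

  coefficient-· : ∀ ε ε′ σ p →
    coefficient (λ i → ε i Sign.* ε′ (σ ⟨$⟩ˡ i)) p ≈ coefficient ε p * coefficient ε′ p
  coefficient-· ε ε′ σ (upper a) = sym (*-identityˡ 1#)
  coefficient-· ε ε′ σ (lower a) = sym (*-identityˡ 1#)
  coefficient-· ε ε′ σ middle    = neg1^-countMinus-· ε ε′ σ

  ρ-· : ∀ w w′ j → ρ (w ·W w′) j ≡ ρ w (ρ w′ j)
  ρ-· (ε , σ) (ε′ , σ′) j = ≡.trans (≡.cong index (signed-compose ε σ ε′ σ′ (pos m j)))
                                    (lift-∘ₛ (signed ε σ) (signed ε′ σ′) j)

  s-homomorphism : ∀ w w′ → s (w ·W w′) ≈M s w ⊗ s w′
  s-homomorphism w@(ε , σ) w′@(ε′ , σ′) = begin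
    s (w ·W w′)                                                ≈⟨ s-monomial (w ·W w′) ⟩
    monomial (ρ (w ·W w′)) (coefficients (w ·W w′))            ≈⟨ monomial-cong (ρ-· w w′) composed ⟩
    monomial (λ j → ρ w (ρ w′ j)) (λ j → coefficients w (ρ w′ j) * coefficients w′ j)
                                                               ≈⟨ monomial-⊗ _ _ _ _ ⟨
    monomial (ρ w) (coefficients w) ⊗ monomial (ρ w′) (coefficients w′)
                                                               ≈⟨ ⊗-cong (s-monomial w) (s-monomial w′) ⟨
    s w ⊗ s w′                                                 ∎
    where
    open ≈M-Reasoning m
    composed : ∀ j → coefficients (w ·W w′) j ≈ coefficients w (ρ w′ j) * coefficients w′ j
    composed j = trans (coefficient-· ε ε′ σ (pos m j)) (*-congʳ (reflexive (≡.sym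
      (≡.trans (≡.cong (coefficient ε) (Lift.pos-lift (signedPerm w′) j)) (coefficient-to ε (signedPerm w′) (pos m j))))))

lemma2p2 : ∀ {c ℓ} (R : CommutativeRing c ℓ) → IsField R →
    (m : ℕ) → 3 ≤ m →
    let open SO R m in
      -- s(w) ∈ SO_m
      (∀ (w : W) → InD (proj₁ w) → InSO (s w))
      -- s(w) normalises T and induces w on T  (s is a section of N(T) → W)
      × (∀ (w : W) → InD (proj₁ w) → ∀ x → InTorus x →
           s w ⊗ diagT x ≈M diagT (actW w x) ⊗ s w)
      -- s is a group homomorphism
      × (∀ (w w' : W) → InD (proj₁ w) → InD (proj₁ w') →
           s (w ·W w') ≈M s w ⊗ s w')
lemma2p2 R _ m 3≤m =
  (λ w w∈D → det-s≈1 w w∈D , s-orthogonal w) ,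
  (λ w _ x _ → s-normalises w x) ,
  (λ w w′ _ _ → s-homomorphism w w′)
  where open WeylSection R m (ℕ.<-≤-trans (ℕ.s≤s ℕ.z≤n) 3≤m)
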